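{- As $h\to\infty$, $|\Omega(h)| = O\left(\frac{5^{h}}{\sqrt{h^{3}}}\right)$.
   Context: For a positive integer $h$, let $\Omega(h)$ (the set of states of the paper's dynamic program for the rectilinear Steiner tree problem) be the set of pairs $(Z,\pi)$ where $Z\subseteq\{1,\dots,h\}$ (the indices of positive-degree vertices) and $\pi$ is a non-crossing partition of $Z$, i.e., there are no $a<b<c<d$ in $Z$ with $a,c$ in one block and $b,d$ in a different block. -}

module Defs where

open import Data.Bool using (Bool; true; false; _∧_; _∨_; not)
open import Data.Nat using (ℕ; zero; suc; _<ᵇ_)
open import Data.Fin using (Fin; toℕ)
open import Data.List using (List; []; _∷_; [_]; concatMap; map; allFin; filterᵇ; length)
open import Data.Nat.ListAction using (sum)
open import Data.Vec using (Vec; lookup) renaming ([] to []ᵥ; _∷_ to _∷ᵥ_)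

_⇒ᵇ_ : Bool → Bool → Bool
a ⇒ᵇ b = not a ∨ b

allᵇ : {h : ℕ} → (Fin h → Bool) → Bool
allᵇ {h} p = Data.List.foldr (λ i acc → p i ∧ acc) true (allFin h)

-- A state (Z, π) is encoded by
--   Z : Vec Bool h           (characteristic vector of Z ⊆ {1..h}, index i ↔ vertex i+1)
--   R : Vec (Vec Bool h) h   (the equivalence relation "same block of π" on Z)
-- Partitions of Z correspond bijectively to equivalence relations on Z.

module _ {h : ℕ} (Z : Vec Bool h) (R : Vec (Vec Bool h) h) where
  inZ : Fin h → Bool
  inZ i = lookup Z i

  rel : Fin h → Fin h → Bool
  rel i j = lookup (lookup R i) j

  isEquivOnZ : Bool
  isEquivOnZ = allᵇ λ i → allᵇ λ j →
       (rel i j ⇒ᵇ (inZ i ∧ inZ j))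
     ∧ (inZ i ⇒ᵇ rel i i)
     ∧ (rel i j ⇒ᵇ rel j i)
     ∧ allᵇ (λ k → (rel i j ∧ rel j k) ⇒ᵇ rel i k)

  _<F_ : Fin h → Fin h → Bool
  a <F b = toℕ a <ᵇ toℕ b

  isNonCrossing : Bool
  isNonCrossing = allᵇ λ a → allᵇ λ b → allᵇ λ c → allᵇ λ d →
    not ( (a <F b) ∧ (b <F c) ∧ (c <F d)
        ∧ inZ a ∧ inZ b ∧ inZ c ∧ inZ d
        ∧ rel a c ∧ rel b d ∧ not (rel a b))

  isState : Bool
  isState = isEquivOnZ ∧ isNonCrossing

vecsOf : {A : Set} → List A → (n : ℕ) → List (Vec A n)
vecsOf xs zero = [ []ᵥ ]
vecsOf xs (suc n) = concatMap (λ v → map (λ x → x ∷ᵥ v) xs) (vecsOf xs n)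

bools : List Bool
bools = false ∷ true ∷ []

cardΩ : ℕ → ℕ
cardΩ h = sum (map (λ Z → length (filterᵇ (isState Z) (vecsOf (vecsOf bools h) h)))
                   (vecsOf bools h))

-- A state (Z, π) is determined by its profile word: for each vertex, whether its block has
-- an earlier and whether it has a later element. Indeed, if j is the block-successor of i,
-- another partition with the same profiles must also link i to its successor and j to its
-- predecessor, and anything else there would cross. Profile words are accepted by an
-- automaton that tracks the number of open blocks, and for |Z| = k it accepts exactly
-- C_k = binom(2k,k)/(k+1) words, a ballot number. Hence |Ω(h)| ≤ Σ_k binom(h,k) C_k.
-- As C_k² (k+1)³ ≤ 16^k, the terms with 2k ≥ h contribute at most 3·5^h h^(-3/2), while
-- the others sum to at most 4^h = o(5^h h^(-3/2)).

module Submission where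

open import Defs
open import Algebra.Properties.CommutativeSemigroup using (interchange)
open import Data.Bool using (Bool; true; false; if_then_else_; T; T?; not; _∧_; _∨_)
import Data.Bool.Properties as Bool
open import Data.Bool.Properties using (∧-conicalˡ; ∧-conicalʳ; not-involutive; T-≡)
open import Data.Empty using (⊥-elim)
open import Data.Fin using (Fin; toℕ; zero; suc)
open import Data.Fin.Induction using (<-wellFounded; >-wellFounded)
open import Data.Fin.Properties using (any?; toℕ-injective)
open import Data.Fin.Subset using (∣_∣)
open import Data.List using (List; []; _∷_; _++_; length; foldr; map; filterᵇ; concatMap; allFin)
import Data.List as List
open import Data.List.Membership.Propositional using (_∈_)
open import Data.List.Membership.Propositional.Properties
  using (∈-map⁺; ∈-map⁻; ∈-concatMap⁺; ∈-∃++; ∈-++⁻; ∈-++⁺ˡ; ∈-++⁺ʳ; ∈-allFin;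
         ∈-filter⁺; ∈-filter⁻)
open import Data.List.Properties using (length-++-sucʳ; map-++; map-∘; map-cong)
import Data.List.Relation.Unary.All as All
open import Data.List.Relation.Unary.AllPairs using (_∷_)
import Data.List.Relation.Unary.AllPairs as AllPairs
import Data.List.Relation.Unary.AllPairs.Properties as AllPairs
open import Data.List.Relation.Unary.Any using (here; there)
import Data.List.Relation.Unary.Any as Any
open import Data.List.Relation.Unary.Unique.Propositional using (Unique)
import Data.List.Relation.Unary.Unique.Propositional.Properties as Unique
open import Data.Nat
open import Data.Nat.Combinatorics using (_C_; nCk+nC[k+1]≡[n+1]C[k+1]; nCk≡nC[n∸k]; nC1≡n)
open import Data.Nat.ListAction using (sum)
open import Data.Nat.ListAction.Properties using (sum-++)
open import Data.Nat.Properties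
open import Data.Nat.Tactic.RingSolver using (solve-∀)
open import Data.Product using (∃-syntax; _×_; _,_; proj₁; proj₂; swap)
open import Data.Sum using (inj₁; inj₂)
open import Data.Vec using (Vec; []; _∷_; lookup; tabulate)
open import Data.Vec.Properties using (∷-injectiveˡ; ∷-injectiveʳ; lookup∘tabulate)
open import Data.Vec.Relation.Binary.Pointwise.Extensional using (ext; Pointwise-≡⇒≡)
open import Function using (_∘_; _∘′_; id; Equivalence; mk⇔)
import Induction.WellFounded as WellFounded
open import Level using (0ℓ)
open import Relation.Binary.Definitions using (tri<; tri≈; tri>)
open import Relation.Binary.PropositionalEquality
open import Relation.Nullary using (¬_; Dec; yes; no; does; contradiction)
open import Relation.Nullary.Decidable using (_×-dec_; dec-true; dec-false)

private variable
  A B : Set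

-- Binomial coefficients

^-distribʳ-* : ∀ m n k → (m * n) ^ k ≡ m ^ k * n ^ k
^-distribʳ-* m n zero    = refl
^-distribʳ-* m n (suc k) =
  trans (cong (m * n *_) (^-distribʳ-* m n k)) (interchange *-commutativeSemigroup m n (m ^ k) (n ^ k))

C-pascal : ∀ n k → suc n C suc k ≡ n C k + n C suc k
C-pascal n k = sym (nCk+nC[k+1]≡[n+1]C[k+1] n k)

C-pascal² : ∀ n k → (2 + n) C (2 + k) ≡ n C k + 2 * (n C suc k) + n C (2 + k)
C-pascal² n k = begin
  (2 + n) C (2 + k)                                 ≡⟨ C-pascal (suc n) (suc k) ⟩
  suc n C suc k + suc n C (2 + k)                   ≡⟨ cong₂ _+_ (C-pascal n k) (C-pascal n (suc k)) ⟩
  n C k + n C suc k + (n C suc k + n C (2 + k))     ≡⟨ regroup (n C k) (n C suc k) (n C (2 + k)) ⟩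
  n C k + 2 * (n C suc k) + n C (2 + k)             ∎
  where
  open ≡-Reasoning
  regroup : ∀ a b c → a + b + (b + c) ≡ a + 2 * b + c
  regroup = solve-∀

C-pascal²-double : ∀ k i → (2 * suc k) C (2 + i) ≡ (2 * k) C i + 2 * ((2 * k) C suc i) + (2 * k) C (2 + i)
C-pascal²-double k i = trans (cong (_C (2 + i)) (*-suc 2 k)) (C-pascal² (2 * k) i)

C-sym : ∀ {n a b} → a + b ≡ n → n C a ≡ n C b
C-sym {a = a} {b} refl = trans (nCk≡nC[n∸k] (m≤m+n a b)) (cong ((a + b) C_) (m+n∸m≡n a b))

C-absorb : ∀ n k → (suc n C suc k) * suc k ≡ (n C k) * suc n
C-absorb zero    zero    = refl
C-absorb zero    (suc k) = refl
C-absorb (suc n) zero    = trans (*-identityʳ _) (trans (nC1≡n (2 + n)) (sym (*-identityˡ (2 + n))))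
C-absorb (suc n) (suc k) = begin
  ((2 + n) C (2 + k)) * (2 + k)
    ≡⟨ cong (_* (2 + k)) (C-pascal (suc n) (suc k)) ⟩
  (suc n C suc k + suc n C (2 + k)) * (2 + k)
    ≡⟨ expand (suc n C suc k) (suc n C (2 + k)) k ⟩
  (suc n C suc k) * suc k + suc n C suc k + (suc n C (2 + k)) * (2 + k)
    ≡⟨ cong₂ (λ x y → x + suc n C suc k + y) (C-absorb n k) (C-absorb n (suc k)) ⟩
  (n C k) * suc n + suc n C suc k + (n C suc k) * suc n
    ≡⟨ cong (λ x → (n C k) * suc n + x + (n C suc k) * suc n) (C-pascal n k) ⟩
  (n C k) * suc n + (n C k + n C suc k) + (n C suc k) * suc n
    ≡⟨ collect (n C k) (n C suc k) n ⟩
  (n C k + n C suc k) * (2 + n)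
    ≡⟨ cong (_* (2 + n)) (C-pascal n k) ⟨
  (suc n C suc k) * (2 + n) ∎
  where
  open ≡-Reasoning
  expand : ∀ a b k → (a + b) * (2 + k) ≡ a * suc k + a + b * (2 + k)
  expand = solve-∀
  collect : ∀ a b n → a * suc n + (a + b) + b * suc n ≡ (a + b) * (2 + n)
  collect = solve-∀

C-centre-ratio : ∀ k → ((2 * k) C suc k) * suc k ≡ ((2 * k) C k) * k
C-centre-ratio zero    = refl
C-centre-ratio (suc k) = begin
  ((2 * suc k) C (2 + k)) * (2 + k)  ≡⟨ cong (λ n → (n C (2 + k)) * (2 + k)) (*-suc 2 k) ⟩
  (suc m C (2 + k)) * (2 + k)        ≡⟨ C-absorb m (suc k) ⟩
  (m C suc k) * suc m                ≡⟨ cong (_* suc m) (C-sym {a = suc k} {k} (halves k)) ⟩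
  (m C k) * suc m                    ≡⟨ C-absorb m k ⟨
  (suc m C suc k) * suc k            ≡⟨ cong (λ n → (n C suc k) * suc k) (*-suc 2 k) ⟨
  ((2 * suc k) C suc k) * suc k      ∎
  where
  open ≡-Reasoning
  m : ℕ
  m = suc (2 * k)
  halves : ∀ k → suc k + k ≡ suc (2 * k)
  halves = solve-∀

C-centre-step : ∀ k → ((2 * suc k) C suc k) * suc k ≡ 2 * ((2 * k) C k) * suc (2 * k)
C-centre-step k = *-cancelʳ-≡ _ _ (suc k) (begin
  ((2 * suc k) C suc k) * suc k * suc k  ≡⟨ cong (λ n → (n C suc k) * suc k * suc k) (*-suc 2 k) ⟩
  (suc m C suc k) * suc k * suc k        ≡⟨ cong (_* suc k) (C-absorb m k) ⟩
  (m C k) * suc m * suc k                ≡⟨ cong (λ x → x * suc m * suc k) (C-sym {a = k} {suc k} (halves k)) ⟩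
  (m C suc k) * suc m * suc k            ≡⟨ commute (m C suc k) (suc m) (suc k) ⟩
  (m C suc k) * suc k * suc m            ≡⟨ cong (_* suc m) (C-absorb (2 * k) k) ⟩
  ((2 * k) C k) * m * suc m              ≡⟨ cong (((2 * k) C k) * m *_) (*-suc 2 k) ⟨
  ((2 * k) C k) * m * (2 * suc k)        ≡⟨ regroup ((2 * k) C k) m (suc k) ⟩
  2 * ((2 * k) C k) * m * suc k          ∎)
  where
  open ≡-Reasoning
  m : ℕ
  m = suc (2 * k)
  halves : ∀ k → k + suc k ≡ suc (2 * k)
  halves = solve-∀
  commute : ∀ a b c → a * b * c ≡ a * c * b
  commute = solve-∀
  regroup : ∀ a b c → a * b * (2 * c) ≡ 2 * a * b * c
  regroup = solve-∀

centralC-bound : ∀ k → ((2 * k) C k) * ((2 * k) C k) * suc k ≤ 16 ^ k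
centralC-bound zero    = ≤-refl
centralC-bound (suc k) = *-cancelʳ-≤ _ _ (suc k * suc k) (begin
  b′ * b′ * (2 + k) * (suc k * suc k)          ≡⟨ regroup₁ b′ (suc k) (2 + k) ⟩
  (b′ * suc k) * (b′ * suc k) * (2 + k)        ≡⟨ cong (λ x → x * x * (2 + k)) (C-centre-step k) ⟩
  (2 * b * m) * (2 * b * m) * (2 + k)          ≡⟨ regroup₂ b m (2 + k) ⟩
  4 * (b * b) * (m * m * (2 + k))              ≤⟨ *-monoʳ-≤ (4 * (b * b)) (cubic k) ⟩
  4 * (b * b) * (4 * (suc k * suc k * suc k))  ≡⟨ regroup₃ b (suc k) ⟩
  16 * (b * b * suc k) * (suc k * suc k)       ≤⟨ *-monoˡ-≤ (suc k * suc k) (*-monoʳ-≤ 16 (centralC-bound k)) ⟩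
  16 ^ suc k * (suc k * suc k)                 ∎)
  where
  open ≤-Reasoning
  b b′ m : ℕ
  b  = (2 * k) C k
  b′ = (2 * suc k) C suc k
  m  = suc (2 * k)
  regroup₁ : ∀ b s t → b * b * t * (s * s) ≡ (b * s) * (b * s) * t
  regroup₁ = solve-∀
  regroup₂ : ∀ b m t → (2 * b * m) * (2 * b * m) * t ≡ 4 * (b * b) * (m * m * t)
  regroup₂ = solve-∀
  regroup₃ : ∀ b s → 4 * (b * b) * (4 * (s * s * s)) ≡ 16 * (b * b * s) * (s * s)
  regroup₃ = solve-∀
  cubic-gap : ∀ k → 4 * (suc k * suc k * suc k) ≡ suc (2 * k) * suc (2 * k) * (2 + k) + (3 * k + 2)
  cubic-gap = solve-∀
  cubic : ∀ k → suc (2 * k) * suc (2 * k) * (2 + k) ≤ 4 * (suc k * suc k * suc k)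
  cubic k = subst (suc (2 * k) * suc (2 * k) * (2 + k) ≤_) (sym (cubic-gap k)) (m≤m+n _ _)

-- Ballot and Catalan numbers

-- ballot k j counts the profile words of k vertices that close j open blocks (see
-- count-accepts). Reading each letter as two ±1 steps makes it a ballot number, whence
-- the reflection-principle formula in ballot-closedForm.
ballot : ℕ → ℕ → ℕ
ballot zero    zero    = 1
ballot zero    (suc j) = 0
ballot (suc k) zero    = ballot k 0 + ballot k 1
ballot (suc k) (suc j) = ballot k (suc j) + ballot k (2 + j) + ballot k (suc j) + ballot k j

catalan : ℕ → ℕ
catalan k = ballot k 0

ballot-closedForm : ∀ k j → ballot k j + (2 * k) C (suc j + k) ≡ (2 * k) C (j + k)
ballot-closedForm zero          zero    = refl
ballot-closedForm zero          (suc j) = refl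
ballot-closedForm (suc zero)    zero    = refl
ballot-closedForm (suc (suc k)) zero    = begin
  ballot (suc k) 0 + ballot (suc k) 1 + (2 * (2 + k)) C (3 + k)
    ≡⟨ cong (ballot (suc k) 0 + ballot (suc k) 1 +_) (C-pascal²-double (suc k) (suc k)) ⟩
  ballot (suc k) 0 + ballot (suc k) 1 + (c (suc k) + 2 * c (2 + k) + c (3 + k))
    ≡⟨ step (ballot-closedForm (suc k) 0) (ballot-closedForm (suc k) 1)
            (C-sym {a = k} {2 + k} (halves k)) ⟩
  c k + 2 * c (suc k) + c (2 + k)
    ≡⟨ C-pascal²-double (suc k) k ⟨
  (2 * (2 + k)) C (2 + k) ∎
  where
  open ≡-Reasoning
  c : ℕ → ℕ
  c i = (2 * suc k) C i
  halves : ∀ k → k + (2 + k) ≡ 2 * suc k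
  halves = solve-∀
  step : ∀ {w₀ w₁ c₀ c₁ c₂ c₃} → w₀ + c₂ ≡ c₁ → w₁ + c₃ ≡ c₂ → c₀ ≡ c₂ →
         (w₀ + w₁) + (c₁ + 2 * c₂ + c₃) ≡ c₀ + 2 * c₁ + c₂
  step {w₀} {w₁} {c₃ = c₃} refl refl refl = identity w₀ w₁ c₃
    where
    identity : ∀ w₀ w₁ c₃ → (w₀ + w₁) + ((w₀ + (w₁ + c₃)) + 2 * (w₁ + c₃) + c₃)
                           ≡ (w₁ + c₃) + 2 * (w₀ + (w₁ + c₃)) + (w₁ + c₃)
    identity = solve-∀
ballot-closedForm (suc k) (suc j) = begin
  ballot (suc k) (suc j) + (2 * suc k) C (2 + j + suc k)
    ≡⟨ cong (λ i → ballot (suc k) (suc j) + (2 * suc k) C (2 + i)) (+-suc j k) ⟩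
  ballot (suc k) (suc j) + (2 * suc k) C (3 + (j + k))
    ≡⟨ cong (ballot (suc k) (suc j) +_) (C-pascal²-double k (suc (j + k))) ⟩
  ballot (suc k) (suc j) + (c (suc (j + k)) + 2 * c (2 + (j + k)) + c (3 + (j + k)))
    ≡⟨ step (ballot-closedForm k j) (ballot-closedForm k (suc j)) (ballot-closedForm k (2 + j)) ⟩
  c (j + k) + 2 * c (suc (j + k)) + c (2 + (j + k))
    ≡⟨ C-pascal²-double k (j + k) ⟨
  (2 * suc k) C (2 + (j + k))
    ≡⟨ cong (λ i → (2 * suc k) C suc i) (+-suc j k) ⟨
  (2 * suc k) C (suc j + suc k) ∎
  where
  open ≡-Reasoning
  c : ℕ → ℕ
  c i = (2 * k) C i
  step : ∀ {w₀ w₁ w₂ c₀ c₁ c₂ c₃} → w₀ + c₁ ≡ c₀ → w₁ + c₂ ≡ c₁ → w₂ + c₃ ≡ c₂ →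
         (w₁ + w₂ + w₁ + w₀) + (c₁ + 2 * c₂ + c₃) ≡ c₀ + 2 * c₁ + c₂
  step {w₀} {w₁} {w₂} {c₃ = c₃} refl refl refl = identity w₀ w₁ w₂ c₃
    where
    identity : ∀ w₀ w₁ w₂ c₃ →
      (w₁ + w₂ + w₁ + w₀) + ((w₁ + (w₂ + c₃)) + 2 * (w₂ + c₃) + c₃)
      ≡ (w₀ + (w₁ + (w₂ + c₃))) + 2 * (w₁ + (w₂ + c₃)) + (w₂ + c₃)
    identity = solve-∀

catalan-central : ∀ k → catalan k * suc k ≡ (2 * k) C k
catalan-central k = +-cancelʳ-≡ (b₀ * k) _ _ (begin
  catalan k * suc k + b₀ * k     ≡⟨ cong (catalan k * suc k +_) (C-centre-ratio k) ⟨
  catalan k * suc k + b₁ * suc k ≡⟨ *-distribʳ-+ (suc k) (catalan k) b₁ ⟨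
  (catalan k + b₁) * suc k       ≡⟨ cong (_* suc k) (ballot-closedForm k 0) ⟩
  b₀ * suc k                     ≡⟨ *-suc b₀ k ⟩
  b₀ + b₀ * k                    ∎)
  where
  open ≡-Reasoning
  b₀ b₁ : ℕ
  b₀ = (2 * k) C k
  b₁ = (2 * k) C suc k

catalan-bound : ∀ k → catalan k * catalan k * suc k ^ 3 ≤ 16 ^ k
catalan-bound k = begin
  catalan k * catalan k * suc k ^ 3                           ≡⟨ regroup (catalan k) (suc k) ⟩
  (catalan k * suc k) * (catalan k * suc k) * suc k           ≡⟨ cong (λ x → x * x * suc k) (catalan-central k) ⟩
  ((2 * k) C k) * ((2 * k) C k) * suc k                       ≤⟨ centralC-bound k ⟩
  16 ^ k                                                      ∎
  where
  open ≤-Reasoning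
  regroup : ∀ c s → c * c * (s * (s * (s * 1))) ≡ (c * s) * (c * s) * s
  regroup = solve-∀

square-cancel-≤ : ∀ {m n} → m * m ≤ n * n → m ≤ n
square-cancel-≤ {m} {n} m²≤n² with m ≤? n
... | yes m≤n = m≤n
... | no  m≰n = contradiction m²≤n² (<⇒≱ (*-mono-< (≰⇒> m≰n) (≰⇒> m≰n)))

catalan≤4^ : ∀ k → catalan k ≤ 4 ^ k
catalan≤4^ k = square-cancel-≤ (begin
  catalan k * catalan k                     ≤⟨ m≤m*n (catalan k * catalan k) (suc k ^ 3) {{m^n≢0 (suc k) 3}} ⟩
  catalan k * catalan k * suc k ^ 3         ≤⟨ catalan-bound k ⟩
  16 ^ k                                    ≡⟨ ^-distribʳ-* 4 4 k ⟩
  4 ^ k * 4 ^ k                             ∎)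
  where open ≤-Reasoning

catalan-sq-bound : ∀ {h k} → h ≤ 2 * k → catalan k * catalan k * h ^ 3 ≤ (3 * 4 ^ k) * (3 * 4 ^ k)
catalan-sq-bound {h} {k} h≤2k = begin
  catalan k * catalan k * h ^ 3              ≤⟨ *-monoʳ-≤ (catalan k * catalan k) (^-monoˡ-≤ 3 h≤2[1+k]) ⟩
  catalan k * catalan k * (2 * suc k) ^ 3    ≡⟨ regroup (catalan k * catalan k) (suc k) ⟩
  8 * (catalan k * catalan k * suc k ^ 3)    ≤⟨ *-monoʳ-≤ 8 (catalan-bound k) ⟩
  8 * 16 ^ k                                 ≤⟨ *-monoˡ-≤ (16 ^ k) (n≤1+n 8) ⟩
  9 * 16 ^ k                                 ≡⟨ cong (9 *_) (^-distribʳ-* 4 4 k) ⟩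
  9 * (4 ^ k * 4 ^ k)                        ≡⟨ regroup₂ (4 ^ k) ⟩
  (3 * 4 ^ k) * (3 * 4 ^ k)                  ∎
  where
  open ≤-Reasoning
  h≤2[1+k] : h ≤ 2 * suc k
  h≤2[1+k] = ≤-trans h≤2k (*-monoʳ-≤ 2 (n≤1+n k))
  regroup : ∀ c s → c * (2 * s * (2 * s * (2 * s * 1))) ≡ 8 * (c * (s * (s * (s * 1))))
  regroup = solve-∀
  regroup₂ : ∀ x → 9 * (x * x) ≡ (3 * x) * (3 * x)
  regroup₂ = solve-∀

-- Binomial sums

-- a * a * D ≤ b * b expresses a √D ≤ b.
sq-bound-* : ∀ {a b c d} D → a * a * D ≤ b * b → c * c * D ≤ d * d → a * c * D ≤ b * d
sq-bound-* {a} {b} {c} {d} D a√D≤b c√D≤d = square-cancel-≤ (begin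
  a * c * D * (a * c * D)   ≡⟨ regroup₁ a c D ⟩
  a * a * D * (c * c * D)   ≤⟨ *-mono-≤ a√D≤b c√D≤d ⟩
  b * b * (d * d)           ≡⟨ regroup₂ b d ⟩
  b * d * (b * d)           ∎)
  where
  open ≤-Reasoning
  regroup₁ : ∀ a c D → a * c * D * (a * c * D) ≡ a * a * D * (c * c * D)
  regroup₁ = solve-∀
  regroup₂ : ∀ b d → b * b * (d * d) ≡ b * d * (b * d)
  regroup₂ = solve-∀

sq-bound-+ : ∀ {a b c d} D → a * a * D ≤ b * b → c * c * D ≤ d * d →
             (a + c) * (a + c) * D ≤ (b + d) * (b + d)
sq-bound-+ {a} {b} {c} {d} D a√D≤b c√D≤d = begin
  (a + c) * (a + c) * D                     ≡⟨ expand a c D ⟩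
  a * a * D + 2 * (a * c * D) + c * c * D   ≤⟨ +-mono-≤ (+-mono-≤ a√D≤b (*-monoʳ-≤ 2 ac√D≤bd)) c√D≤d ⟩
  b * b + 2 * (b * d) + d * d               ≡⟨ square b d ⟨
  (b + d) * (b + d)                         ∎
  where
  open ≤-Reasoning
  ac√D≤bd : a * c * D ≤ b * d
  ac√D≤bd = sq-bound-* {a} {b} {c} {d} D a√D≤b c√D≤d
  expand : ∀ a c D → (a + c) * (a + c) * D ≡ a * a * D + 2 * (a * c * D) + c * c * D
  expand = solve-∀
  square : ∀ b d → (b + d) * (b + d) ≡ b * b + 2 * (b * d) + d * d
  square = solve-∀

-- binomialSum h F = Σₖ C(h,k) F k, by Pascal's rule.
binomialSum : ℕ → (ℕ → ℕ) → ℕ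
binomialSum zero    F = F 0
binomialSum (suc h) F = binomialSum h F + binomialSum h (F ∘ suc)

binomialSum-mono : ∀ h {F G} → (∀ k → F k ≤ G k) → binomialSum h F ≤ binomialSum h G
binomialSum-mono zero    F≤G = F≤G 0
binomialSum-mono (suc h) F≤G = +-mono-≤ (binomialSum-mono h F≤G) (binomialSum-mono h (F≤G ∘ suc))

binomialSum-cong : ∀ h {F G} → (∀ k → F k ≡ G k) → binomialSum h F ≡ binomialSum h G
binomialSum-cong h F≡G =
  ≤-antisym (binomialSum-mono h (≤-reflexive ∘ F≡G)) (binomialSum-mono h (≤-reflexive ∘ sym ∘ F≡G))

binomialSum-+ : ∀ h F G → binomialSum h (λ k → F k + G k) ≡ binomialSum h F + binomialSum h G
binomialSum-+ zero    F G = refl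
binomialSum-+ (suc h) F G =
  trans (cong₂ _+_ (binomialSum-+ h F G) (binomialSum-+ h (F ∘ suc) (G ∘ suc)))
        (interchange +-commutativeSemigroup (binomialSum h F) (binomialSum h G) _ _)

binomialSum-const : ∀ h c → binomialSum h (λ _ → c) ≡ c * 2 ^ h
binomialSum-const zero    c = sym (*-identityʳ c)
binomialSum-const (suc h) c = begin
  binomialSum h (λ _ → c) + binomialSum h (λ _ → c) ≡⟨ cong (λ x → x + x) (binomialSum-const h c) ⟩
  c * 2 ^ h + c * 2 ^ h                             ≡⟨ double c (2 ^ h) ⟩
  c * (2 * 2 ^ h)                                   ∎
  where
  open ≡-Reasoning
  double : ∀ c x → c * x + c * x ≡ c * (2 * x)
  double = solve-∀

binomialSum-geometric : ∀ h a c → binomialSum h (λ k → c * a ^ k) ≡ c * suc a ^ h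
binomialSum-geometric zero    a c = refl
binomialSum-geometric (suc h) a c = begin
  binomialSum h (λ k → c * a ^ k) + binomialSum h (λ k → c * (a * a ^ k))
    ≡⟨ cong (binomialSum h (λ k → c * a ^ k) +_) (binomialSum-cong h (λ k → *-assoc c a (a ^ k))) ⟨
  binomialSum h (λ k → c * a ^ k) + binomialSum h (λ k → c * a * a ^ k)
    ≡⟨ cong₂ _+_ (binomialSum-geometric h a c) (binomialSum-geometric h a (c * a)) ⟩
  c * suc a ^ h + c * a * suc a ^ h
    ≡⟨ collect c a (suc a ^ h) ⟩
  c * (suc a * suc a ^ h) ∎
  where
  open ≡-Reasoning
  collect : ∀ c a x → c * x + c * a * x ≡ c * (suc a * x)
  collect = solve-∀

binomialSum-sq-mono : ∀ h D {F G} → (∀ k → F k * F k * D ≤ G k * G k) →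
                      binomialSum h F * binomialSum h F * D ≤ binomialSum h G * binomialSum h G
binomialSum-sq-mono zero    D F≤G = F≤G 0
binomialSum-sq-mono (suc h) D {F} {G} F≤G =
  sq-bound-+ {binomialSum h F} {binomialSum h G} {binomialSum h (F ∘ suc)} {binomialSum h (G ∘ suc)} D
         (binomialSum-sq-mono h D F≤G) (binomialSum-sq-mono h D (F≤G ∘ suc))

cube-growth : ∀ h → 7 ≤ h → 16 * suc h ^ 3 ≤ 25 * h ^ 3
cube-growth h 7≤h = *-cancelˡ-≤ 343 (begin
  343 * (16 * suc h ^ 3)   ≡⟨ regroup₁ (suc h) ⟩
  16 * (7 * suc h) ^ 3     ≤⟨ *-monoʳ-≤ 16 (^-monoˡ-≤ 3 7[1+h]≤8h) ⟩
  16 * (8 * h) ^ 3         ≡⟨ regroup₂ h ⟩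
  8192 * h ^ 3             ≤⟨ *-monoˡ-≤ (h ^ 3) (≤ᵇ⇒≤ 8192 8575 _) ⟩
  8575 * h ^ 3             ≡⟨ *-assoc 343 25 (h ^ 3) ⟩
  343 * (25 * h ^ 3)       ∎)
  where
  open ≤-Reasoning
  7[1+h]≤8h : 7 * suc h ≤ 8 * h
  7[1+h]≤8h = subst (_≤ 8 * h) (sym (*-suc 7 h)) (+-monoˡ-≤ (7 * h) 7≤h)
  regroup₁ : ∀ x → 343 * (16 * (x * (x * (x * 1)))) ≡ 16 * (7 * x * (7 * x * (7 * x * 1)))
  regroup₁ = solve-∀
  regroup₂ : ∀ x → 16 * (8 * x * (8 * x * (8 * x * 1))) ≡ 8192 * (x * (x * (x * 1)))
  regroup₂ = solve-∀

16^h*h³≤16*25^h : ∀ h → 7 ≤ h → 16 ^ h * h ^ 3 ≤ 16 * 25 ^ h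
16^h*h³≤16*25^h h 7≤h = subst (λ h → 16 ^ h * h ^ 3 ≤ 16 * 25 ^ h) (m+[n∸m]≡n 7≤h) (from7 (h ∸ 7))
  where
  from7 : ∀ t → 16 ^ (7 + t) * (7 + t) ^ 3 ≤ 16 * 25 ^ (7 + t)
  from7 zero    = ≤ᵇ⇒≤ _ _ _
  from7 (suc t) = begin
    16 * 16 ^ n * suc n ^ 3      ≡⟨ shuffle₁ (16 ^ n) (suc n ^ 3) ⟩
    16 ^ n * (16 * suc n ^ 3)    ≤⟨ *-monoʳ-≤ (16 ^ n) (cube-growth n (m≤m+n 7 t)) ⟩
    16 ^ n * (25 * n ^ 3)        ≡⟨ shuffle₂ (16 ^ n) (n ^ 3) ⟩
    25 * (16 ^ n * n ^ 3)        ≤⟨ *-monoʳ-≤ 25 (from7 t) ⟩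
    25 * (16 * 25 ^ n)           ≡⟨ shuffle₃ (25 ^ n) ⟩
    16 * (25 * 25 ^ n)           ∎
    where
    open ≤-Reasoning
    n : ℕ
    n = 7 + t
    shuffle₁ : ∀ x y → 16 * x * y ≡ x * (16 * y)
    shuffle₁ = solve-∀
    shuffle₂ : ∀ x y → x * (25 * y) ≡ 25 * (x * y)
    shuffle₂ = solve-∀
    shuffle₃ : ∀ x → 25 * (16 * x) ≡ 16 * (25 * x)
    shuffle₃ = solve-∀

catalanAbove catalanBelow : ℕ → ℕ → ℕ
catalanAbove h k = if h ≤ᵇ 2 * k then catalan k else 0
catalanBelow h k = if h ≤ᵇ 2 * k then 0 else catalan k

binomialSum-catalan-split : ∀ h →
  binomialSum h catalan ≡ binomialSum h (catalanAbove h) + binomialSum h (catalanBelow h)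
binomialSum-catalan-split h =
  trans (binomialSum-cong h pointwise) (binomialSum-+ h (catalanAbove h) (catalanBelow h))
  where
  pointwise : ∀ k → catalan k ≡ catalanAbove h k + catalanBelow h k
  pointwise k with h ≤ᵇ 2 * k
  ... | true  = sym (+-identityʳ (catalan k))
  ... | false = refl

binomialSum-catalanAbove : ∀ h →
  binomialSum h (catalanAbove h) * binomialSum h (catalanAbove h) * h ^ 3 ≤ (3 * 5 ^ h) * (3 * 5 ^ h)
binomialSum-catalanAbove h = begin
  binomialSum h (catalanAbove h) * binomialSum h (catalanAbove h) * h ^ 3
    ≤⟨ binomialSum-sq-mono h (h ^ 3) above-sq ⟩
  binomialSum h (λ k → 3 * 4 ^ k) * binomialSum h (λ k → 3 * 4 ^ k)
    ≡⟨ cong (λ x → x * x) (binomialSum-geometric h 4 3) ⟩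
  (3 * 5 ^ h) * (3 * 5 ^ h) ∎
  where
  open ≤-Reasoning
  above-sq : ∀ k → catalanAbove h k * catalanAbove h k * h ^ 3 ≤ (3 * 4 ^ k) * (3 * 4 ^ k)
  above-sq k with h ≤ᵇ 2 * k in eq
  ... | true  = catalan-sq-bound {h} {k} (≤ᵇ⇒≤ h (2 * k) (subst T (sym eq) _))
  ... | false = z≤n

binomialSum-catalanBelow : ∀ h → binomialSum h (catalanBelow h) ≤ 4 ^ h
binomialSum-catalanBelow h = begin
  binomialSum h (catalanBelow h)  ≤⟨ binomialSum-mono h below≤ ⟩
  binomialSum h (λ _ → 2 ^ h)     ≡⟨ binomialSum-const h (2 ^ h) ⟩
  2 ^ h * 2 ^ h                   ≡⟨ ^-distribʳ-* 2 2 h ⟨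
  4 ^ h                           ∎
  where
  open ≤-Reasoning
  below≤ : ∀ k → catalanBelow h k ≤ 2 ^ h
  below≤ k with h ≤ᵇ 2 * k in eq
  ... | true  = z≤n
  ... | false = begin
    catalan k    ≤⟨ catalan≤4^ k ⟩
    4 ^ k        ≡⟨ ^-*-assoc 2 2 k ⟩
    2 ^ (2 * k)  ≤⟨ ^-monoʳ-≤ 2 (<⇒≤ (≰⇒> h≰2k)) ⟩
    2 ^ h        ∎
    where
    h≰2k : ¬ h ≤ 2 * k
    h≰2k h≤2k = subst T eq (≤⇒≤ᵇ h≤2k)

binomialSum-catalan-bound : ∀ h → 7 ≤ h →
  binomialSum h catalan * binomialSum h catalan * h ^ 3 ≤ 49 * 25 ^ h
binomialSum-catalan-bound h 7≤h = begin
  binomialSum h catalan * binomialSum h catalan * h ^ 3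
    ≡⟨ cong (λ x → x * x * h ^ 3) (binomialSum-catalan-split h) ⟩
  (above + below) * (above + below) * h ^ 3
    ≤⟨ sq-bound-+ {above} {3 * 5 ^ h} {below} {4 * 5 ^ h} (h ^ 3) (binomialSum-catalanAbove h) below-part ⟩
  (3 * 5 ^ h + 4 * 5 ^ h) * (3 * 5 ^ h + 4 * 5 ^ h)
    ≡⟨ collect (5 ^ h) ⟩
  49 * (5 ^ h * 5 ^ h)
    ≡⟨ cong (49 *_) (^-distribʳ-* 5 5 h) ⟨
  49 * 25 ^ h ∎
  where
  open ≤-Reasoning
  above below : ℕ
  above = binomialSum h (catalanAbove h)
  below = binomialSum h (catalanBelow h)
  below≤4^h : below ≤ 4 ^ h
  below≤4^h = binomialSum-catalanBelow h
  below-part : below * below * h ^ 3 ≤ (4 * 5 ^ h) * (4 * 5 ^ h)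
  below-part = begin
    below * below * h ^ 3        ≤⟨ *-monoˡ-≤ (h ^ 3) (*-mono-≤ below≤4^h below≤4^h) ⟩
    4 ^ h * 4 ^ h * h ^ 3        ≡⟨ cong (_* h ^ 3) (^-distribʳ-* 4 4 h) ⟨
    16 ^ h * h ^ 3               ≤⟨ 16^h*h³≤16*25^h h 7≤h ⟩
    16 * 25 ^ h                  ≡⟨ cong (16 *_) (^-distribʳ-* 5 5 h) ⟩
    16 * (5 ^ h * 5 ^ h)         ≡⟨ regroup (5 ^ h) ⟩
    (4 * 5 ^ h) * (4 * 5 ^ h)    ∎
    where
    regroup : ∀ x → 16 * (x * x) ≡ (4 * x) * (4 * x)
    regroup = solve-∀
  collect : ∀ x → (3 * x + 4 * x) * (3 * x + 4 * x) ≡ 49 * (x * x)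
  collect = solve-∀

-- Counting in lists

indicator : Bool → ℕ
indicator true  = 1
indicator false = 0

count : (A → Bool) → List A → ℕ
count p xs = length (filterᵇ p xs)

count-as-sum : ∀ (p : A → Bool) xs → count p xs ≡ sum (map (indicator ∘ p) xs)
count-as-sum p []       = refl
count-as-sum p (x ∷ xs) with p x
... | true  = cong suc (count-as-sum p xs)
... | false = count-as-sum p xs

sum-map-+ : ∀ (f g : A → ℕ) xs → sum (map (λ x → f x + g x) xs) ≡ sum (map f xs) + sum (map g xs)
sum-map-+ f g []       = refl
sum-map-+ f g (x ∷ xs) =
  trans (cong (f x + g x +_) (sum-map-+ f g xs)) (interchange +-commutativeSemigroup (f x) (g x) _ _)

sum-map-zero : ∀ (xs : List A) → sum (map (λ _ → 0) xs) ≡ 0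
sum-map-zero []       = refl
sum-map-zero (x ∷ xs) = sum-map-zero xs

count-false : ∀ (xs : List A) → count (λ _ → false) xs ≡ 0
count-false xs = trans (count-as-sum (λ _ → false) xs) (sum-map-zero xs)

sum-map-mono : ∀ {f g : A → ℕ} → (∀ x → f x ≤ g x) → ∀ xs → sum (map f xs) ≤ sum (map g xs)
sum-map-mono f≤g []       = z≤n
sum-map-mono f≤g (x ∷ xs) = +-mono-≤ (f≤g x) (sum-map-mono f≤g xs)

∈-filterᵇ⁺ : ∀ (p : A → Bool) {xs x} → x ∈ xs → p x ≡ true → x ∈ filterᵇ p xs
∈-filterᵇ⁺ p x∈xs px = ∈-filter⁺ (T? ∘ p) x∈xs (Equivalence.from T-≡ px)

∈-filterᵇ⁻ : ∀ (p : A → Bool) xs {x} → x ∈ filterᵇ p xs → p x ≡ true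
∈-filterᵇ⁻ p xs x∈ = Equivalence.to T-≡ (proj₂ (∈-filter⁻ (T? ∘ p) {xs = xs} x∈))

length-≤-injection : (f : A → B) {xs : List A} {ys : List B} → Unique xs →
  (∀ {x} → x ∈ xs → f x ∈ ys) → (∀ {x y} → x ∈ xs → y ∈ xs → f x ≡ f y → x ≡ y) →
  length xs ≤ length ys
length-≤-injection f {[]}     _             _    _   = z≤n
length-≤-injection f {x ∷ xs} (x∉xs ∷ uniq) into inj with ∈-∃++ (into (here refl))
... | us , vs , refl = subst (suc (length xs) ≤_) (sym (length-++-sucʳ us (f x) vs))
  (s≤s (length-≤-injection f uniq into′ (λ p q → inj (there p) (there q))))
  where
  into′ : ∀ {y} → y ∈ xs → f y ∈ us ++ vs
  into′ {y} y∈xs with ∈-++⁻ us (into (there y∈xs))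
  ... | inj₁ fy∈us         = ∈-++⁺ˡ fy∈us
  ... | inj₂ (here fy≡fx)  = ⊥-elim (All.lookup x∉xs y∈xs (inj (here refl) (there y∈xs) (sym fy≡fx)))
  ... | inj₂ (there fy∈vs) = ∈-++⁺ʳ us fy∈vs

vecsOf-unique : ∀ {xs : List A} → Unique xs → ∀ n → Unique (vecsOf xs n)
vecsOf-unique u zero    = All.[] AllPairs.∷ AllPairs.[]
vecsOf-unique {xs = xs} u (suc n) =
  Unique.concat⁺ (All.tabulate λ {ys} ys∈ → unique-layer ys∈)
                 (AllPairs.map⁺ (AllPairs.map disjoint (vecsOf-unique u n)))
  where
  unique-layer : ∀ {ys} → ys ∈ map (λ v → map (_∷ v) xs) (vecsOf xs n) → Unique ys
  unique-layer ys∈ with ∈-map⁻ (λ v → map (_∷ v) xs) ys∈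
  ... | v , _ , refl = Unique.map⁺ ∷-injectiveˡ u
  disjoint : ∀ {v w : Vec _ n} → v ≢ w → ∀ {y} → ¬ (y ∈ map (_∷ v) xs × y ∈ map (_∷ w) xs)
  disjoint {v} {w} v≢w (y∈ , y∈′) with ∈-map⁻ (_∷ v) y∈ | ∈-map⁻ (_∷ w) y∈′
  ... | _ , _ , refl | _ , _ , eq = v≢w (∷-injectiveʳ eq)

vecsOf-complete : ∀ {xs : List A} → (∀ x → x ∈ xs) → ∀ {n} (v : Vec A n) → v ∈ vecsOf xs n
vecsOf-complete all []      = here refl
vecsOf-complete {xs = xs} all (x ∷ v) =
  ∈-concatMap⁺ (λ w → map (_∷ w) xs)
    (Any.map (λ { refl → ∈-map⁺ (_∷ v) (all x) }) (vecsOf-complete all v))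

bools-unique : Unique bools
bools-unique = ((λ ()) All.∷ All.[]) AllPairs.∷ (All.[] AllPairs.∷ AllPairs.[])

sum-vecsOf-suc : ∀ (xs : List A) n (f : Vec A (suc n) → ℕ) →
  sum (map f (vecsOf xs (suc n))) ≡ sum (map (λ x → sum (map (λ v → f (x ∷ v)) (vecsOf xs n))) xs)
sum-vecsOf-suc xs n f = go (vecsOf xs n)
  where
  go : ∀ vs → sum (map f (concatMap (λ v → map (_∷ v) xs) vs))
            ≡ sum (map (λ x → sum (map (λ v → f (x ∷ v)) vs)) xs)
  go []       = sym (sum-map-zero xs)
  go (v ∷ vs) = begin
    sum (map f (map (_∷ v) xs ++ concatMap (λ v → map (_∷ v) xs) vs))
      ≡⟨ cong sum (map-++ f (map (_∷ v) xs) _) ⟩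
    sum (map f (map (_∷ v) xs) ++ map f (concatMap (λ v → map (_∷ v) xs) vs))
      ≡⟨ sum-++ (map f (map (_∷ v) xs)) _ ⟩
    sum (map f (map (_∷ v) xs)) + sum (map f (concatMap (λ v → map (_∷ v) xs) vs))
      ≡⟨ cong₂ _+_ (cong sum (map-∘ xs)) (sym (go vs)) ⟨
    sum (map (λ x → f (x ∷ v)) xs) + sum (map (λ x → sum (map (λ v → f (x ∷ v)) vs)) xs)
      ≡⟨ sum-map-+ (λ x → f (x ∷ v)) _ xs ⟨
    sum (map (λ x → f (x ∷ v) + sum (map (λ v → f (x ∷ v)) vs)) xs) ∎
    where open ≡-Reasoning

count-vecsOf-suc : ∀ (xs : List A) n (p : Vec A (suc n) → Bool) →
  count p (vecsOf xs (suc n)) ≡ sum (map (λ x → count (λ v → p (x ∷ v)) (vecsOf xs n)) xs)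
count-vecsOf-suc xs n p = begin
  count p (vecsOf xs (suc n))                                               ≡⟨ count-as-sum p (vecsOf xs (suc n)) ⟩
  sum (map (indicator ∘ p) (vecsOf xs (suc n)))                             ≡⟨ sum-vecsOf-suc xs n _ ⟩
  sum (map (λ x → sum (map (λ v → indicator (p (x ∷ v))) (vecsOf xs n))) xs)
    ≡⟨ cong sum (map-cong (λ x → count-as-sum (λ v → p (x ∷ v)) (vecsOf xs n)) xs) ⟨
  sum (map (λ x → count (λ v → p (x ∷ v)) (vecsOf xs n)) xs)                ∎
  where open ≡-Reasoning

sum-subsets : ∀ h F → sum (map (F ∘ ∣_∣) (vecsOf bools h)) ≡ binomialSum h F
sum-subsets zero    F = +-identityʳ (F 0)
sum-subsets (suc h) F = begin
  sum (map (F ∘ ∣_∣) (vecsOf bools (suc h)))                                   ≡⟨ sum-vecsOf-suc bools h _ ⟩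
  sum (map (F ∘ ∣_∣) (vecsOf bools h)) + (sum (map (F ∘ suc ∘ ∣_∣) (vecsOf bools h)) + 0)
    ≡⟨ cong₂ (λ x y → x + (y + 0)) (sum-subsets h F) (sum-subsets h (F ∘ suc)) ⟩
  binomialSum h F + (binomialSum h (F ∘ suc) + 0)
    ≡⟨ cong (binomialSum h F +_) (+-identityʳ _) ⟩
  binomialSum h F + binomialSum h (F ∘ suc)                                   ∎
  where open ≡-Reasoning

countFin : ∀ {n} → (Fin n → Bool) → ℕ
countFin {zero}  p = 0
countFin {suc n} p = indicator (p zero) + countFin (p ∘ suc)

countFin-false : ∀ {n} → countFin {n} (λ _ → false) ≡ 0
countFin-false {zero}  = refl
countFin-false {suc n} = countFin-false {n}

count-tabulate : ∀ {n} (p : A → Bool) (g : Fin n → A) → count p (List.tabulate g) ≡ countFin (p ∘ g)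
count-tabulate {n = zero}  p g = refl
count-tabulate {n = suc n} p g with p (g zero)
... | true  = cong suc (count-tabulate p (g ∘ suc))
... | false = count-tabulate p (g ∘ suc)

count-allFin : ∀ {n} (p : Fin n → Bool) → count p (allFin n) ≡ countFin p
count-allFin p = count-tabulate p (λ i → i)

unique-filterᵇ-allFin : ∀ {n} (p : Fin n → Bool) → Unique (filterᵇ p (allFin n))
unique-filterᵇ-allFin {n} p = Unique.filter⁺ (T? ∘ p) (Unique.allFin⁺ n)

countBefore : ∀ {n} → Fin n → (Fin n → Bool) → ℕ
countBefore i p = countFin (λ x → (toℕ x <ᵇ toℕ i) ∧ p x)

-- Profile words

-- The profile of a vertex: whether its block has an earlier, and whether it has a later element.
Profile : Set
Profile = Bool × Bool

profiles : List Profile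
profiles = (false , false) ∷ (false , true) ∷ (true , true) ∷ (true , false) ∷ []

∈-profiles : ∀ x → x ∈ profiles
∈-profiles (false , false) = here refl
∈-profiles (false , true)  = there (here refl)
∈-profiles (true  , true)  = there (there (here refl))
∈-profiles (true  , false) = there (there (there (here refl)))

-- The depth d is the number of blocks opened but not yet closed.
accepts : ∀ {n} → Vec Bool n → ℕ → Vec Profile n → Bool
accepts []          zero    []                   = true
accepts []          (suc d) []                   = false
accepts (false ∷ Z) d       ((e , l) ∷ w)        = not (e ∨ l) ∧ accepts Z d w
accepts (true ∷ Z)  d       ((false , false) ∷ w) = accepts Z d w
accepts (true ∷ Z)  d       ((false , true) ∷ w)  = accepts Z (suc d) w
accepts (true ∷ Z)  zero    ((true , _) ∷ w)      = false
accepts (true ∷ Z)  (suc d) ((true , true) ∷ w)   = accepts Z (suc d) w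
accepts (true ∷ Z)  (suc d) ((true , false) ∷ w)  = accepts Z d w

count-accepts : ∀ n (Z : Vec Bool n) d → count (accepts Z d) (vecsOf profiles n) ≡ ballot ∣ Z ∣ d
count-accepts zero    []          zero    = refl
count-accepts zero    []          (suc d) = refl
count-accepts (suc n) (z ∷ Z)     d       = trans (count-vecsOf-suc profiles n _) (by-first-letter z d)
  where
  open ≡-Reasoning
  k : ℕ
  k = ∣ Z ∣
  N : (Vec Profile n → Bool) → ℕ
  N p = count p (vecsOf profiles n)
  none : N (λ _ → false) ≡ 0
  none = count-false (vecsOf profiles n)
  by-first-letter : ∀ z d →
    sum (map (λ x → N (λ v → accepts (z ∷ Z) d (x ∷ v))) profiles) ≡ ballot ∣ z ∷ Z ∣ d
  by-first-letter false d = begin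
    N (accepts Z d) + (N (λ _ → false) + (N (λ _ → false) + (N (λ _ → false) + 0)))
      ≡⟨ cong (λ x → N (accepts Z d) + (x + (x + (x + 0)))) none ⟩
    N (accepts Z d) + 0           ≡⟨ +-identityʳ _ ⟩
    N (accepts Z d)               ≡⟨ count-accepts n Z d ⟩
    ballot k d                    ∎
  by-first-letter true zero = begin
    N (accepts Z 0) + (N (accepts Z 1) + (N (λ _ → false) + (N (λ _ → false) + 0)))
      ≡⟨ cong (λ x → N (accepts Z 0) + (N (accepts Z 1) + (x + (x + 0)))) none ⟩
    N (accepts Z 0) + (N (accepts Z 1) + 0)
      ≡⟨ cong (N (accepts Z 0) +_) (+-identityʳ _) ⟩
    N (accepts Z 0) + N (accepts Z 1)
      ≡⟨ cong₂ _+_ (count-accepts n Z 0) (count-accepts n Z 1) ⟩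
    ballot k 0 + ballot k 1 ∎
  by-first-letter true (suc d) = begin
    N (accepts Z (suc d)) + (N (accepts Z (2 + d)) + (N (accepts Z (suc d)) + (N (accepts Z d) + 0)))
      ≡⟨ regroup (N (accepts Z (suc d))) (N (accepts Z (2 + d))) (N (accepts Z (suc d))) (N (accepts Z d)) ⟩
    N (accepts Z (suc d)) + N (accepts Z (2 + d)) + N (accepts Z (suc d)) + N (accepts Z d)
      ≡⟨ cong₂ _+_ (cong₂ _+_ (cong₂ _+_ (count-accepts n Z (suc d)) (count-accepts n Z (2 + d)))
                                (count-accepts n Z (suc d))) (count-accepts n Z d) ⟩
    ballot (suc k) (suc d) ∎
    where
    regroup : ∀ a b c d → a + (b + (c + (d + 0))) ≡ a + b + c + d
    regroup = solve-∀

opens closes : Profile → Bool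
opens  (e , l) = not e ∧ l
closes (e , l) = e ∧ not l

accepts-criterion : ∀ {n} (Z : Vec Bool n) (w : Fin n → Profile) d →
  (∀ i → lookup Z i ≡ false → w i ≡ (false , false)) →
  (∀ i → proj₁ (w i) ≡ true → suc (countBefore i (closes ∘ w)) ≤ d + countBefore i (opens ∘ w)) →
  countFin (closes ∘ w) ≡ d + countFin (opens ∘ w) →
  accepts Z d (tabulate w) ≡ true
accepts-criterion []      w zero    _ _ _ = refl
accepts-criterion []      w (suc d) _ _ ()
accepts-criterion (false ∷ Z) w d silent nested balanced with w zero in w₀
... | false , false = accepts-criterion Z (w ∘ suc) d (silent ∘ suc) (nested ∘ suc) balanced
... | false , true  with () ← trans (sym w₀) (silent zero refl)
... | true  , _     with () ← trans (sym w₀) (silent zero refl)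
accepts-criterion {suc n} (true ∷ Z) w d silent nested balanced with w zero in w₀ | d
... | false , false | d     = accepts-criterion Z (w ∘ suc) d (silent ∘ suc) (nested ∘ suc) balanced
... | false , true  | d     = accepts-criterion Z (w ∘ suc) (suc d) (silent ∘ suc)
  (λ i e → subst (suc (countBefore i (closes ∘ w ∘ suc)) ≤_) (+-suc d _) (nested (suc i) e))
  (trans balanced (+-suc d _))
... | true  , _     | zero
  with () ← subst (suc (countBefore zero (closes ∘ w)) ≤_) (countFin-false {n}) (nested zero (cong proj₁ w₀))
... | true  , true  | suc d = accepts-criterion Z (w ∘ suc) (suc d) (silent ∘ suc) (nested ∘ suc) balanced
... | true  , false | suc d = accepts-criterion Z (w ∘ suc) d (silent ∘ suc)
  (λ i e → ≤-pred (nested (suc i) e)) (suc-injective balanced)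

-- Non-crossing states

allᵇ-elim : ∀ {h} {p : Fin h → Bool} → allᵇ p ≡ true → ∀ i → p i ≡ true
allᵇ-elim {h} {p} all-p i = go (allFin h) all-p (∈-allFin i)
  where
  go : ∀ is → foldr (λ i acc → p i ∧ acc) true is ≡ true → i ∈ is → p i ≡ true
  go (j ∷ is) eq (here refl) = ∧-conicalˡ (p j) _ eq
  go (j ∷ is) eq (there i∈) = go is (∧-conicalʳ (p j) _ eq) i∈

⇒ᵇ-elim : ∀ {a b} → (a ⇒ᵇ b) ≡ true → a ≡ true → b ≡ true
⇒ᵇ-elim {true} b≡true refl = b≡true

<⇒<ᵇ≡true : ∀ {m n} → m < n → (m <ᵇ n) ≡ true
<⇒<ᵇ≡true m<n = Equivalence.to T-≡ (<⇒<ᵇ m<n)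

<ᵇ≡true⇒< : ∀ {m n} → (m <ᵇ n) ≡ true → m < n
<ᵇ≡true⇒< {m} {n} eq = <ᵇ⇒< m n (Equivalence.from T-≡ eq)

does⇒ : ∀ {P : Set} (P? : Dec P) → does P? ≡ true → P
does⇒ (yes p) _ = p

does-≡⇒ : ∀ {P Q : Set} (P? : Dec P) (Q? : Dec Q) → does P? ≡ does Q? → P → Q
does-≡⇒ (yes _) Q? eq _ = does⇒ Q? (sym eq)
does-≡⇒ (no ¬p) Q? eq p = contradiction p ¬p

≡-by-trichotomy : ∀ {n} {i j : Fin n} → ¬ toℕ i < toℕ j → ¬ toℕ j < toℕ i → i ≡ j
≡-by-trichotomy {i = i} {j} i≮j j≮i with <-cmp (toℕ i) (toℕ j)
... | tri< i<j _ _ = contradiction i<j i≮j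
... | tri≈ _ i≡j _ = toℕ-injective i≡j
... | tri> _ _ j<i = contradiction j<i j≮i

record IsState {h} (Z : Vec Bool h) (R : Vec (Vec Bool h) h) : Set where
  field
    inZˡ        : ∀ {i j} → rel Z R i j ≡ true → lookup Z i ≡ true
    inZʳ        : ∀ {i j} → rel Z R i j ≡ true → lookup Z j ≡ true
    reflexive   : ∀ {i} → lookup Z i ≡ true → rel Z R i i ≡ true
    symmetric   : ∀ {i j} → rel Z R i j ≡ true → rel Z R j i ≡ true
    transitive  : ∀ {i j k} → rel Z R i j ≡ true → rel Z R j k ≡ true → rel Z R i k ≡ true
    nonCrossing : ∀ {a b c d} → toℕ a < toℕ b → toℕ b < toℕ c → toℕ c < toℕ d →
                  rel Z R a c ≡ true → rel Z R b d ≡ true → rel Z R a b ≡ true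

isState⇒IsState : ∀ {h} (Z : Vec Bool h) R → isState Z R ≡ true → IsState Z R
isState⇒IsState {h} Z R eq = record
  { inZˡ        = λ {i} {j} r → ∧-conicalˡ (lookup Z i) _ (⇒ᵇ-elim (support i j) r)
  ; inZʳ        = λ {i} {j} r → ∧-conicalʳ (lookup Z i) _ (⇒ᵇ-elim (support i j) r)
  ; reflexive   = λ {i} → ⇒ᵇ-elim (reflexiveᵇ i)
  ; symmetric   = λ {i} {j} → ⇒ᵇ-elim (symmetricᵇ i j)
  ; transitive  = λ {i} {j} {k} r s → ⇒ᵇ-elim (transitiveᵇ i j k) (cong₂ _∧_ r s)
  ; nonCrossing = nonCrossing
  }
  where
  supportClause symmetricClause : Fin h → Fin h → Bool
  supportClause i j   = rel Z R i j ⇒ᵇ (lookup Z i ∧ lookup Z j)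
  symmetricClause i j = rel Z R i j ⇒ᵇ rel Z R j i
  reflexiveClause : Fin h → Bool
  reflexiveClause i = lookup Z i ⇒ᵇ rel Z R i i
  equivalence : isEquivOnZ Z R ≡ true
  equivalence = ∧-conicalˡ (isEquivOnZ Z R) _ eq
  nonCrossingᵇ : isNonCrossing Z R ≡ true
  nonCrossingᵇ = ∧-conicalʳ (isEquivOnZ Z R) _ eq
  support : ∀ i j → supportClause i j ≡ true
  support i j = ∧-conicalˡ (supportClause i j) _ (allᵇ-elim (allᵇ-elim equivalence i) j)
  reflexiveᵇ : ∀ i → reflexiveClause i ≡ true
  reflexiveᵇ i = ∧-conicalˡ (reflexiveClause i) _
    (∧-conicalʳ (supportClause i i) _ (allᵇ-elim (allᵇ-elim equivalence i) i))
  symmetricᵇ : ∀ i j → symmetricClause i j ≡ true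
  symmetricᵇ i j = ∧-conicalˡ (symmetricClause i j) _ (∧-conicalʳ (reflexiveClause i) _
    (∧-conicalʳ (supportClause i j) _ (allᵇ-elim (allᵇ-elim equivalence i) j)))
  transitiveᵇ : ∀ i j k → ((rel Z R i j ∧ rel Z R j k) ⇒ᵇ rel Z R i k) ≡ true
  transitiveᵇ i j = allᵇ-elim (∧-conicalʳ (symmetricClause i j) _ (∧-conicalʳ (reflexiveClause i) _
    (∧-conicalʳ (supportClause i j) _ (allᵇ-elim (allᵇ-elim equivalence i) j))))
  nonCrossing : ∀ {a b c d} → toℕ a < toℕ b → toℕ b < toℕ c → toℕ c < toℕ d →
                rel Z R a c ≡ true → rel Z R b d ≡ true → rel Z R a b ≡ true
  nonCrossing {a} {b} {c} {d} a<b b<c c<d ac bd =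
    trans (sym (not-involutive _))
      (peel bd (peel ac (peel zd (peel zc (peel zb (peel za
        (peel (<⇒<ᵇ≡true c<d) (peel (<⇒<ᵇ≡true b<c) (peel (<⇒<ᵇ≡true a<b)
          (allᵇ-elim (allᵇ-elim (allᵇ-elim (allᵇ-elim nonCrossingᵇ a) b) c) d))))))))))
    where
    peel : ∀ {x y} → x ≡ true → not (x ∧ y) ≡ true → not y ≡ true
    peel refl = id
    za : lookup Z a ≡ true
    za = ∧-conicalˡ (lookup Z a) _ (⇒ᵇ-elim (support a c) ac)
    zc : lookup Z c ≡ true
    zc = ∧-conicalʳ (lookup Z a) _ (⇒ᵇ-elim (support a c) ac)
    zb : lookup Z b ≡ true
    zb = ∧-conicalˡ (lookup Z b) _ (⇒ᵇ-elim (support b d) bd)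
    zd : lookup Z d ≡ true
    zd = ∧-conicalʳ (lookup Z b) _ (⇒ᵇ-elim (support b d) bd)

module Blocks {h : ℕ} (Z : Vec Bool h) (R : Vec (Vec Bool h) h) where

  infix 4 _∼_
  _∼_ : Fin h → Fin h → Set
  i ∼ j = rel Z R i j ≡ true

  Earlier Later : Fin h → Set
  Earlier i = ∃[ j ] toℕ j < toℕ i × j ∼ i
  Later   i = ∃[ j ] toℕ i < toℕ j × i ∼ j

  earlier? : ∀ i → Dec (Earlier i)
  earlier? i = any? λ j → toℕ j <? toℕ i ×-dec rel Z R j i Bool.≟ true

  later? : ∀ i → Dec (Later i)
  later? i = any? λ j → toℕ i <? toℕ j ×-dec rel Z R i j Bool.≟ true

  profile : Fin h → Profile
  profile i = does (earlier? i) , does (later? i)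

module NonCrossingState {h : ℕ} {Z : Vec Bool h} {R : Vec (Vec Bool h) h} (st : IsState Z R) where
  open IsState st
  open Blocks Z R

  blockStart : ∀ i → ∃[ m ] (lookup Z i ≡ true → toℕ m ≤ toℕ i × m ∼ i × ¬ Earlier m)
  blockStart = WellFounded.All.wfRec <-wellFounded 0ℓ _ step
    where
    step : ∀ i → (∀ {j} → toℕ j < toℕ i →
                    ∃[ m ] (lookup Z j ≡ true → toℕ m ≤ toℕ j × m ∼ j × ¬ Earlier m)) →
           ∃[ m ] (lookup Z i ≡ true → toℕ m ≤ toℕ i × m ∼ i × ¬ Earlier m)
    step i rec with earlier? i
    ... | no ¬earlier = i , λ i∈Z → ≤-refl , reflexive i∈Z , ¬earlier
    ... | yes (j , j<i , j∼i) with rec j<i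
    ...   | m , spec = m , λ _ → let m≤j , m∼j , ¬earlier = spec (inZˡ j∼i)
                                 in ≤-trans m≤j (<⇒≤ j<i) , transitive m∼j j∼i , ¬earlier

  blockEnd : ∀ i → ∃[ m ] (lookup Z i ≡ true → toℕ i ≤ toℕ m × i ∼ m × ¬ Later m)
  blockEnd = WellFounded.All.wfRec >-wellFounded 0ℓ _ step
    where
    step : ∀ i → (∀ {j} → toℕ j > toℕ i →
                    ∃[ m ] (lookup Z j ≡ true → toℕ j ≤ toℕ m × j ∼ m × ¬ Later m)) →
           ∃[ m ] (lookup Z i ≡ true → toℕ i ≤ toℕ m × i ∼ m × ¬ Later m)
    step i rec with later? i
    ... | no ¬later = i , λ i∈Z → ≤-refl , reflexive i∈Z , ¬later
    ... | yes (j , i<j , i∼j) with rec i<j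
    ...   | m , spec = m , λ _ → let j≤m , j∼m , ¬later = spec (inZʳ i∼j)
                                 in ≤-trans (<⇒≤ i<j) j≤m , transitive i∼j j∼m , ¬later

  start end : Fin h → Fin h
  start i = proj₁ (blockStart i)
  end   i = proj₁ (blockEnd i)

  Opener Closer : Fin h → Set
  Opener i = ¬ Earlier i × Later i
  Closer i = Earlier i × ¬ Later i

  start-earlier : ∀ {i} → Earlier i → toℕ (start i) < toℕ i × start i ∼ i × Opener (start i)
  start-earlier {i} earlier@(_ , _ , j∼i) with proj₂ (blockStart i) (inZʳ j∼i)
  ... | m≤i , m∼i , ¬earlier = m<i , m∼i , ¬earlier , (i , m<i , m∼i)
    where
    m<i : toℕ (start i) < toℕ i
    m<i = ≤∧≢⇒< m≤i (λ m≡i → ¬earlier (subst Earlier (sym (toℕ-injective m≡i)) earlier))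

  end-later : ∀ {i} → Later i → toℕ i < toℕ (end i) × i ∼ end i × Closer (end i)
  end-later {i} later@(_ , _ , i∼j) with proj₂ (blockEnd i) (inZˡ i∼j)
  ... | i≤m , i∼m , ¬later = i<m , i∼m , (i , i<m , i∼m) , ¬later
    where
    i<m : toℕ i < toℕ (end i)
    i<m = ≤∧≢⇒< i≤m (λ i≡m → ¬later (subst Later (toℕ-injective i≡m) later))

  opens-profile⁺ : ∀ {i} → Opener i → opens (profile i) ≡ true
  opens-profile⁺ {i} (¬earlier , later) rewrite dec-false (earlier? i) ¬earlier | dec-true (later? i) later = refl

  closes-profile⁺ : ∀ {i} → Closer i → closes (profile i) ≡ true
  closes-profile⁺ {i} (earlier , ¬later) rewrite dec-true (earlier? i) earlier | dec-false (later? i) ¬later = refl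

  opens-profile⁻ : ∀ {i} → opens (profile i) ≡ true → Opener i
  opens-profile⁻ {i} eq with earlier? i | later? i
  opens-profile⁻ {i} eq | no ¬earlier | yes later = ¬earlier , later
  opens-profile⁻ {i} () | yes _       | _
  opens-profile⁻ {i} () | no _        | no _

  closes-profile⁻ : ∀ {i} → closes (profile i) ≡ true → Closer i
  closes-profile⁻ {i} eq with earlier? i | later? i
  closes-profile⁻ {i} eq | yes earlier | no ¬later = earlier , ¬later
  closes-profile⁻ {i} () | no _        | _
  closes-profile⁻ {i} () | yes _       | yes _

  profile-outside : ∀ i → lookup Z i ≡ false → profile i ≡ (false , false)
  profile-outside i i∉Z with earlier? i | later? i
  ... | no _                  | no _                  = refl
  ... | yes (_ , _ , j∼i)     | _                     = contradiction (trans (sym (inZʳ j∼i)) i∉Z) λ ()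
  ... | no _                  | yes (_ , _ , i∼j)     = contradiction (trans (sym (inZˡ i∼j)) i∉Z) λ ()

  same-start⇒∼ : ∀ {i j} → Earlier i → Earlier j → start i ≡ start j → i ∼ j
  same-start⇒∼ ei ej eq with start-earlier ei | start-earlier ej
  ... | _ , m∼i , _ | _ , m′∼j , _ = transitive (symmetric m∼i) (subst (_∼ _) (sym eq) m′∼j)

  same-end⇒∼ : ∀ {i j} → Later i → Later j → end i ≡ end j → i ∼ j
  same-end⇒∼ li lj eq with end-later li | end-later lj
  ... | _ , i∼m , _ | _ , j∼m′ , _ = transitive i∼m (symmetric (subst (_ ∼_) (sym eq) j∼m′))

  openers closers : List (Fin h)
  openers = filterᵇ (opens ∘ profile) (allFin h)
  closers = filterᵇ (closes ∘ profile) (allFin h)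

  closers≤openers : countFin (closes ∘ profile) ≤ countFin (opens ∘ profile)
  closers≤openers = subst₂ _≤_ (count-allFin (closes ∘ profile)) (count-allFin (opens ∘ profile))
    (length-≤-injection start (unique-filterᵇ-allFin (closes ∘ profile)) into injective)
    where
    closer : ∀ {y} → y ∈ closers → Closer y
    closer y∈ = closes-profile⁻ (∈-filterᵇ⁻ (closes ∘ profile) (allFin h) y∈)
    into : ∀ {y} → y ∈ closers → start y ∈ openers
    into y∈ = let _ , _ , opener = start-earlier (proj₁ (closer y∈))
              in ∈-filterᵇ⁺ (opens ∘ profile) (∈-allFin _) (opens-profile⁺ opener)
    injective : ∀ {y y′} → y ∈ closers → y′ ∈ closers →
                start y ≡ start y′ → y ≡ y′
    injective {y} {y′} y∈ y′∈ eq =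
      ≡-by-trichotomy (λ y<y′ → proj₂ (closer y∈) (y′ , y<y′ , y∼y′))
                      (λ y′<y → proj₂ (closer y′∈) (y , y′<y , symmetric y∼y′))
      where
      y∼y′ : y ∼ y′
      y∼y′ = same-start⇒∼ (proj₁ (closer y∈)) (proj₁ (closer y′∈)) eq

  openers≤closers : countFin (opens ∘ profile) ≤ countFin (closes ∘ profile)
  openers≤closers = subst₂ _≤_ (count-allFin (opens ∘ profile)) (count-allFin (closes ∘ profile))
    (length-≤-injection end (unique-filterᵇ-allFin (opens ∘ profile)) into injective)
    where
    opener : ∀ {y} → y ∈ openers → Opener y
    opener y∈ = opens-profile⁻ (∈-filterᵇ⁻ (opens ∘ profile) (allFin h) y∈)
    into : ∀ {y} → y ∈ openers → end y ∈ closers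
    into y∈ = let _ , _ , closer = end-later (proj₂ (opener y∈))
              in ∈-filterᵇ⁺ (closes ∘ profile) (∈-allFin _) (closes-profile⁺ closer)
    injective : ∀ {y y′} → y ∈ openers → y′ ∈ openers →
                end y ≡ end y′ → y ≡ y′
    injective {y} {y′} y∈ y′∈ eq =
      ≡-by-trichotomy (λ y<y′ → proj₁ (opener y′∈) (y , y<y′ , y∼y′))
                      (λ y′<y → proj₁ (opener y∈) (y′ , y′<y , symmetric y∼y′))
      where
      y∼y′ : y ∼ y′
      y∼y′ = same-end⇒∼ (proj₂ (opener y∈)) (proj₂ (opener y′∈)) eq

  earlier-nested : ∀ i → Earlier i →
                   suc (countBefore i (closes ∘ profile)) ≤ countBefore i (opens ∘ profile)
  earlier-nested i earlier =
    subst₂ (λ c o → suc c ≤ o) (count-allFin closerBefore) (count-allFin openerBefore)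
    (length-≤-injection start (unique-cons ∷ unique-filterᵇ-allFin closerBefore) into injective)
    where
    closerBefore openerBefore : Fin h → Bool
    closerBefore x = (toℕ x <ᵇ toℕ i) ∧ closes (profile x)
    openerBefore x = (toℕ x <ᵇ toℕ i) ∧ opens (profile x)

    closersBefore openersBefore : List (Fin h)
    closersBefore = filterᵇ closerBefore (allFin h)
    openersBefore = filterᵇ openerBefore (allFin h)

    closer-before : ∀ {y} → y ∈ closersBefore → toℕ y < toℕ i × Closer y
    closer-before y∈ with ∈-filterᵇ⁻ closerBefore (allFin h) y∈
    ... | eq = <ᵇ≡true⇒< (∧-conicalˡ (toℕ _ <ᵇ toℕ i) _ eq)
             , closes-profile⁻ (∧-conicalʳ (toℕ _ <ᵇ toℕ i) _ eq)

    unique-cons : All.All (i ≢_) closersBefore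
    unique-cons = All.tabulate λ y∈ i≡y → <-irrefl (cong toℕ (sym i≡y)) (proj₁ (closer-before y∈))

    before-opener : ∀ {m} → toℕ m < toℕ i → Opener m → m ∈ openersBefore
    before-opener m<i opener =
      ∈-filterᵇ⁺ openerBefore (∈-allFin _) (cong₂ _∧_ (<⇒<ᵇ≡true m<i) (opens-profile⁺ opener))

    into : ∀ {y} → y ∈ i ∷ closersBefore → start y ∈ openersBefore
    into (here refl) = let m<i , _ , opener = start-earlier earlier in before-opener m<i opener
    into (there y∈)  = let y<i , closer = closer-before y∈
                           m<y , _ , opener = start-earlier (proj₁ closer)
                       in before-opener (<-trans m<y y<i) opener

    earlier-member : ∀ {y} → y ∈ i ∷ closersBefore → Earlier y
    earlier-member (here refl) = earlier
    earlier-member (there y∈)  = proj₁ (proj₂ (closer-before y∈))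

    ≤-member : ∀ {y} → y ∈ i ∷ closersBefore → toℕ y ≤ toℕ i
    ≤-member (here refl) = ≤-refl
    ≤-member (there y∈)  = <⇒≤ (proj₁ (closer-before y∈))

    ¬later-below : ∀ {y y′} → y ∈ i ∷ closersBefore → y′ ∈ i ∷ closersBefore →
                   toℕ y < toℕ y′ → ¬ Later y
    ¬later-below (here refl) y′∈ i<y′ = contradiction (≤-member y′∈) (<⇒≱ i<y′)
    ¬later-below (there y∈)  _   _    = proj₂ (proj₂ (closer-before y∈))

    injective : ∀ {y y′} → y ∈ i ∷ closersBefore → y′ ∈ i ∷ closersBefore →
                start y ≡ start y′ → y ≡ y′
    injective {y} {y′} y∈ y′∈ eq =
      ≡-by-trichotomy (λ y<y′ → ¬later-below y∈ y′∈ y<y′ (y′ , y<y′ , y∼y′))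
                      (λ y′<y → ¬later-below y′∈ y∈ y′<y (y , y′<y , symmetric y∼y′))
      where
      y∼y′ : y ∼ y′
      y∼y′ = same-start⇒∼ (earlier-member y∈) (earlier-member y′∈) eq

  profile-accepted : accepts Z 0 (tabulate profile) ≡ true
  profile-accepted = accepts-criterion Z profile 0 profile-outside
    (λ i flag → earlier-nested i (does⇒ (earlier? i) flag))
    (≤-antisym closers≤openers openers≤closers)

span : ∀ {h} → Fin h → Fin h → ℕ
span i j = toℕ j ∸ toℕ i

module Agreement {h : ℕ} {Z : Vec Bool h} {R₁ R₂ : Vec (Vec Bool h) h}
  (st₁ : IsState Z R₁) (st₂ : IsState Z R₂)
  (earlier⇒ : ∀ {i} → Blocks.Earlier Z R₁ i → Blocks.Earlier Z R₂ i)
  (later⇒   : ∀ {i} → Blocks.Later Z R₁ i → Blocks.Later Z R₂ i) where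

  open Blocks Z R₁ using () renaming (_∼_ to _∼₁_)
  open Blocks Z R₂ using () renaming (_∼_ to _∼₂_)
  module S₁ = IsState st₁
  module S₂ = IsState st₂

  -- If an element of i's R₁-block lies strictly between i and j, split at it. Otherwise j is
  -- the R₁-successor of i, and the R₂-successor m of i and R₂-predecessor p of j must be j
  -- and i: m < j or i < p contradicts the induction hypothesis, and p < i < j < m would cross.
  agree-step : ∀ {i j} → toℕ i < toℕ j →
    (∀ {a b} → toℕ a < toℕ b → span a b < span i j →
               (a ∼₁ b → a ∼₂ b) × (a ∼₂ b → a ∼₁ b)) →
    i ∼₁ j → i ∼₂ j
  agree-step {i} {j} i<j agree i∼₁j
    with any? (λ m → toℕ i <? toℕ m ×-dec toℕ m <? toℕ j ×-dec rel Z R₁ i m Bool.≟ true)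
  ... | yes (m , i<m , m<j , i∼₁m) =
    S₂.transitive (proj₁ (agree i<m (∸-monoˡ-< m<j (<⇒≤ i<m))) i∼₁m)
                  (proj₁ (agree m<j (∸-monoʳ-< i<m (<⇒≤ m<j))) (S₁.transitive (S₁.symmetric i∼₁m) i∼₁j))
  ... | no nothing-between with later⇒ (j , i<j , i∼₁j)
  ...   | m , i<m , i∼₂m with <-cmp (toℕ m) (toℕ j)
  ...     | tri≈ _ m≡j _ = subst (i ∼₂_) (toℕ-injective m≡j) i∼₂m
  ...     | tri< m<j _ _ =
    contradiction (m , i<m , m<j , proj₂ (agree i<m (∸-monoˡ-< m<j (<⇒≤ i<m))) i∼₂m) nothing-between
  ...     | tri> _ _ j<m with earlier⇒ (i , i<j , i∼₁j)
  ...       | p , p<j , p∼₂j with <-cmp (toℕ p) (toℕ i)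
  ...         | tri≈ _ p≡i _ = subst (_∼₂ j) (toℕ-injective p≡i) p∼₂j
  ...         | tri> _ _ i<p =
    contradiction (p , i<p , p<j , S₁.transitive i∼₁j (S₁.symmetric p∼₁j)) nothing-between
    where
    p∼₁j : p ∼₁ j
    p∼₁j = proj₂ (agree p<j (∸-monoʳ-< i<p (<⇒≤ p<j))) p∼₂j
  ...         | tri< p<i _ _ = S₂.transitive (S₂.symmetric (S₂.nonCrossing p<i i<j j<m p∼₂j i∼₂m)) p∼₂j

module _ {h : ℕ} {Z : Vec Bool h} {R₁ R₂ : Vec (Vec Bool h) h}
         (st₁ : IsState Z R₁) (st₂ : IsState Z R₂) where

  profile-injective : (∀ i → Blocks.profile Z R₁ i ≡ Blocks.profile Z R₂ i) → R₁ ≡ R₂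
  profile-injective same = Pointwise-≡⇒≡ (ext λ i → Pointwise-≡⇒≡ (ext λ j → rel-≡ i j))
    where
    open Blocks Z R₁ using () renaming (_∼_ to _∼₁_; earlier? to earlier₁?; later? to later₁?)
    open Blocks Z R₂ using () renaming (_∼_ to _∼₂_; earlier? to earlier₂?; later? to later₂?)
    module S₁ = IsState st₁
    module S₂ = IsState st₂
    module A₁ = Agreement st₁ st₂ (λ {i} → does-≡⇒ (earlier₁? i) (earlier₂? i) (cong proj₁ (same i)))
                                  (λ {i} → does-≡⇒ (later₁? i) (later₂? i) (cong proj₂ (same i)))
    module A₂ = Agreement st₂ st₁ (λ {i} → does-≡⇒ (earlier₂? i) (earlier₁? i) (cong proj₁ (sym (same i))))
                                  (λ {i} → does-≡⇒ (later₂? i) (later₁? i) (cong proj₂ (sym (same i))))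

    agree : ∀ d {i j} → toℕ i < toℕ j → span i j < d → (i ∼₁ j → i ∼₂ j) × (i ∼₂ j → i ∼₁ j)
    agree (suc d) {i} {j} i<j span<d = A₁.agree-step i<j IH , A₂.agree-step i<j (λ a<b s → swap (IH a<b s))
      where
      IH : ∀ {a b} → toℕ a < toℕ b → span a b < span i j →
           (a ∼₁ b → a ∼₂ b) × (a ∼₂ b → a ∼₁ b)
      IH a<b span<span = agree d a<b (≤-trans span<span (≤-pred span<d))

    rel-≡ : ∀ i j → rel Z R₁ i j ≡ rel Z R₂ i j
    rel-≡ i j with <-cmp (toℕ i) (toℕ j)
    ... | tri< i<j _ _ = let to , from = agree _ i<j ≤-refl in Bool.⇔→≡ (mk⇔ to from)
    ... | tri> _ _ j<i = let to , from = agree _ j<i ≤-refl in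
      Bool.⇔→≡ (mk⇔ (S₂.symmetric ∘ to ∘ S₁.symmetric) (S₁.symmetric ∘ from ∘ S₂.symmetric))
    ... | tri≈ _ i≡j _ rewrite toℕ-injective i≡j =
      Bool.⇔→≡ (mk⇔ (S₂.reflexive ∘ S₁.inZˡ) (S₁.reflexive ∘ S₂.inZˡ))

-- Counting states

count-states≤catalan : ∀ h (Z : Vec Bool h) → count (isState Z) (vecsOf (vecsOf bools h) h) ≤ catalan ∣ Z ∣
count-states≤catalan h Z = subst (count (isState Z) relations ≤_) (count-accepts h Z 0)
  (length-≤-injection (tabulate ∘′ Blocks.profile Z) unique into injective)
  where
  relations : List (Vec (Vec Bool h) h)
  relations = vecsOf (vecsOf bools h) h
  state : ∀ {R} → R ∈ filterᵇ (isState Z) relations → IsState Z R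
  state {R} R∈ = isState⇒IsState Z R (∈-filterᵇ⁻ (isState Z) relations R∈)
  unique : Unique (filterᵇ (isState Z) relations)
  unique = Unique.filter⁺ _ (vecsOf-unique (vecsOf-unique bools-unique h) h)
  into : ∀ {R} → R ∈ filterᵇ (isState Z) relations →
         tabulate (Blocks.profile Z R) ∈ filterᵇ (accepts Z 0) (vecsOf profiles h)
  into R∈ = ∈-filterᵇ⁺ (accepts Z 0) (vecsOf-complete ∈-profiles _)
                      (NonCrossingState.profile-accepted (state R∈))
  injective : ∀ {R R′} → R ∈ filterᵇ (isState Z) relations → R′ ∈ filterᵇ (isState Z) relations →
              tabulate (Blocks.profile Z R) ≡ tabulate (Blocks.profile Z R′) → R ≡ R′
  injective {R} {R′} R∈ R′∈ eq = profile-injective (state R∈) (state R′∈) λ i →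
    trans (sym (lookup∘tabulate _ i)) (trans (cong (λ w → lookup w i) eq) (lookup∘tabulate _ i))

cardΩ≤binomialSum : ∀ h → cardΩ h ≤ binomialSum h catalan
cardΩ≤binomialSum h =
  ≤-trans (sum-map-mono (count-states≤catalan h) (vecsOf bools h)) (≤-reflexive (sum-subsets h catalan))

theorem2 : ∃[ C ] ∃[ N ] ((h : ℕ) → N ≤ h → cardΩ h * cardΩ h * h ^ 3 ≤ C * 25 ^ h)
theorem2 = 49 , 7 , λ h 7≤h → begin
  cardΩ h * cardΩ h * h ^ 3
    ≤⟨ *-monoˡ-≤ (h ^ 3) (*-mono-≤ (cardΩ≤binomialSum h) (cardΩ≤binomialSum h)) ⟩
  binomialSum h catalan * binomialSum h catalan * h ^ 3
    ≤⟨ binomialSum-catalan-bound h 7≤h ⟩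
  49 * 25 ^ h ∎
  where open ≤-Reasoning
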